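{- Let $\mathsf{M}$ be a matroid on $[n]$ without loops, $K$ a field, $E=K\langle e_1,\dots,e_n\rangle$ the exterior algebra and $J$ the Orlik–Solomon ideal of $\mathsf{M}$. Then for every $i\in[n]$ the variable $e_i$ is $E/J$-regular. In particular, $\operatorname{depth}E/J\geq1$.
   Context: A matroid on $[n]$ is a nonempty family of subsets of $[n]$ (independent sets) containing $\emptyset$, closed under subsets, and satisfying the exchange axiom; non-independent subsets are dependent; a loop is an element $i$ with $\{i\}$ dependent. $E$ is standard graded with $\deg e_i=1$; for $S=\{i_0<\dots<i_m\}\subseteq[n]$, $e_S=e_{i_0}\wedge\dots\wedge e_{i_m}$ and $\partial e_S=\sum_{j=0}^m(-1)^je_{S\setminus\{i_j\}}$. The Orlik–Solomon ideal is $J=(\partial e_S: S\subseteq[n]\text{ dependent})$. For a graded module $N$, $v\in E_1$ is $N$-regular if $0:_Nv=vN$; a sequence $v_1,\dots,v_s\in E_1$ is $N$-regular if $v_i$ is $N/(v_1,\dots,v_{i-1})N$-regular for each $i$ and $N/(v_1,\dots,v_s)N\neq0$; $\operatorname{depth}N$ is the common length of maximal $N$-regular sequences. -}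

module Defs where

open import Level using (Level; _⊔_) renaming (suc to lsuc)
open import Data.Nat using (ℕ; zero; suc; _<_)
open import Data.Bool using (Bool; true; false; if_then_else_)
open import Data.Vec using (Vec; []; _∷_)
open import Data.Fin using (Fin)
open import Data.Fin.Subset using (Subset; _∈_; _∉_; _⊆_; _∪_; ⁅_⁆; ∣_∣; _─_)
  renaming (⊥ to ∅)
open import Data.Product using (Σ; ∃; _×_; _,_)
open import Data.List using (List; []; _∷_)
open import Relation.Nullary using (¬_)
open import Algebra.Bundles using (CommutativeRing)

record Field (c ℓ : Level) : Set (lsuc (c ⊔ ℓ)) where
  field
    commutativeRing : CommutativeRing c ℓ
  open CommutativeRing commutativeRing public
  field
    1≉0     : ¬ (1# ≈ 0#)
    inverse : ∀ x → ¬ (x ≈ 0#) → Σ Carrier λ y → (x * y) ≈ 1#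

record Matroid (n : ℕ) : Set₁ where
  field
    Indep     : Subset n → Set
    indep-∅   : Indep ∅
    indep-⊆   : ∀ {I J} → I ⊆ J → Indep J → Indep I
    exchange  : ∀ {I J} → Indep I → Indep J → ∣ I ∣ < ∣ J ∣ →
                ∃ λ x → x ∈ J × x ∉ I × Indep (I ∪ ⁅ x ⁆)

  Dependent : Subset n → Set
  Dependent S = ¬ Indep S

  IsLoop : Fin n → Set
  IsLoop i = Dependent ⁅ i ⁆

  Loopless : Set
  Loopless = ∀ i → ¬ IsLoop i

-- The exterior algebra E = K⟨e_1,…,e_n⟩ over a field K.
-- An element is given by its coefficients in the basis (e_S)_{S ⊆ [n]},
-- where e_S = e_{i_0} ∧ … ∧ e_{i_m} for S = {i_0 < … < i_m}.

module Exterior {c ℓ : Level} (K : Field c ℓ) where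
  open Field K

  E : ℕ → Set c
  E n = Subset n → Carrier

  _≈E_ : ∀ {n} → E n → E n → Set ℓ
  x ≈E y = ∀ S → x S ≈ y S

  0E : ∀ {n} → E n
  0E S = 0#

  _+E_ : ∀ {n} → E n → E n → E n
  (x +E y) S = x S + y S

  -E_ : ∀ {n} → E n → E n
  (-E x) S = - x S

  _-E_ : ∀ {n} → E n → E n → E n
  x -E y = x +E (-E y)

  basis : ∀ {n} → Subset n → E n
  basis [] [] = 1#
  basis (b ∷ S) (b' ∷ T) with b | b'
  ... | true  | true  = basis S T
  ... | false | false = basis S T
  ... | _     | _     = 0#

  1E : ∀ {n} → E n
  1E = basis ∅

  var : ∀ {n} → Fin n → E n
  var i = basis ⁅ i ⁆

  -- split x on [n+1] as x = x₀ + e_0 ∧ x₁ with x₀, x₁ not involving e_0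
  lo hi : ∀ {n} → E (suc n) → E n
  lo x S = x (false ∷ S)
  hi x S = x (true ∷ S)

  join : ∀ {n} → E n → E n → E (suc n)
  join x₀ x₁ (false ∷ S) = x₀ S
  join x₀ x₁ (true  ∷ S) = x₁ S

  -- parity involution: e_S ↦ (-1)^|S| e_S
  inv : ∀ {n} → E n → E n
  inv {zero}  x = x
  inv {suc n} x = join (inv (lo x)) (-E inv (hi x))

  -- exterior product, via
  -- (x₀ + e₀x₁)(y₀ + e₀y₁) = x₀y₀ + e₀(x₁y₀ + inv(x₀)y₁)
  infixl 7 _∧_
  _∧_ : ∀ {n} → E n → E n → E n
  _∧_ {zero}  x y [] = x [] * y []
  _∧_ {suc n} x y =
    join (lo x ∧ lo y) ((hi x ∧ lo y) +E (inv (lo x) ∧ hi y))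

  -- the boundary map ∂ (linear, ∂ e_S = Σ_j (-1)^j e_{S∖{i_j}}), via
  -- ∂(x₀ + e₀x₁) = ∂x₀ + x₁ - e₀ ∧ ∂x₁
  ∂ : ∀ {n} → E n → E n
  ∂ {zero}  x = 0E
  ∂ {suc n} x = join (∂ (lo x) +E hi x) (-E ∂ (hi x))

  Pred : ℕ → Set (lsuc (c ⊔ ℓ))
  Pred n = E n → Set (c ⊔ ℓ)

  data OS {n} (M : Matroid n) : E n → Set (c ⊔ ℓ) where
    os-zero : ∀ {x} → x ≈E 0E → OS M x
    os-gen  : ∀ {x} (a b : E n) (S : Subset n) → Matroid.Dependent M S →
              x ≈E (a ∧ ∂ (basis S) ∧ b) → OS M x
    os-add  : ∀ {x} y z → OS M y → OS M z → x ≈E (y +E z) → OS M x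

  _+⟨_⟩ : ∀ {n} → Pred n → E n → Pred n
  (I +⟨ v ⟩) x = ∃ λ y → I (x -E (v ∧ y))

  -- For N = E/I:  v is N-regular iff 0 :_N v = vN, i.e. for all x ∈ E,
  -- v x ∈ I  ⇔  x ∈ I + vE.
  IsRegular : ∀ {n} → Pred n → E n → Set (c ⊔ ℓ)
  IsRegular I v = ∀ x → (I (v ∧ x) → (I +⟨ v ⟩) x) × ((I +⟨ v ⟩) x → I (v ∧ x))

  NonZeroQuot : ∀ {n} → Pred n → Set (c ⊔ ℓ)
  NonZeroQuot I = ¬ (∀ x → I x)

  IsRegularSeq : ∀ {n} → Pred n → List (E n) → Set (c ⊔ ℓ)
  IsRegularSeq I []       = NonZeroQuot I
  IsRegularSeq I (v ∷ vs) = IsRegular I v × IsRegularSeq (I +⟨ v ⟩) vs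

-- ∂ is a derivation of E twisted by the parity involution, ∂(x ∧ y) = ∂x ∧ y + inv x ∧ ∂y,
-- with ∂∂ = 0 and ∂e_i = 1. As J is generated by boundaries ∂e_S and inv ∂e_S = ±∂e_S, the
-- Leibniz rule shows that J is stable under ∂. For v = e_i it gives x = ∂(v ∧ x) + v ∧ ∂x,
-- so v ∧ x ∈ J forces x ∈ J + vE; conversely v ∧ (x - v ∧ y) = v ∧ x because v ∧ v = 0.
-- Without loops every dependent S has at least two elements, so J lies in the augmentation
-- ideal; hence 1 ∉ J + vE and the quotient is nonzero.

module Submission where

open import Defs
open import Level using (Level)
open import Data.Nat using (ℕ; zero; suc)
open import Data.Fin using (Fin; zero; suc)
open import Data.Bool using (true; false)
open import Data.Vec using ([]; _∷_)
open import Data.List using ([]; _∷_)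
open import Data.Fin.Subset using (Subset; ⁅_⁆) renaming (⊥ to ∅)
open import Data.Product using (∃; _×_; _,_)
open import Data.Sum using (_⊎_; inj₁; inj₂)
open import Data.Empty using (⊥-elim)
open import Relation.Binary.PropositionalEquality as P using (_≡_; subst; cong)
open import Algebra.Bundles using (Group; AbelianGroup)
import Algebra.Construct.Pointwise as Pointwise
import Algebra.Properties.AbelianGroup as AbelianGroupProperties
import Algebra.Properties.CommutativeSemigroup as CommutativeSemigroupProperties
import Algebra.Properties.Group as GroupProperties
import Algebra.Properties.Ring as RingProperties
import Relation.Binary.Reasoning.Setoid as SetoidReasoning
import Algebra.Solver.CommutativeMonoid as CommutativeMonoidSolver

module AdditiveMap {a ℓa b ℓb} (G : Group a ℓa) (H : Group b ℓb) where
  private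
    module G = Group G
    module H = Group H
  open Group H using (_≈_; _∙_; ε; _⁻¹)
  open GroupProperties H using (identityˡ-unique; inverseˡ-unique)
  open SetoidReasoning H.setoid

  module _ {f : G.Carrier → H.Carrier}
           (f-cong : ∀ {x y} → x G.≈ y → f x ≈ f y)
           (f-∙ : ∀ x y → f (x G.∙ y) ≈ (f x ∙ f y)) where

    ε-homo : f G.ε ≈ ε
    ε-homo = identityˡ-unique (f G.ε) (f G.ε) (begin
      f G.ε ∙ f G.ε    ≈⟨ f-∙ G.ε G.ε ⟨
      f (G.ε G.∙ G.ε)  ≈⟨ f-cong (G.identityˡ G.ε) ⟩
      f G.ε            ∎)

    ⁻¹-homo : ∀ x → f (x G.⁻¹) ≈ f x ⁻¹
    ⁻¹-homo x = inverseˡ-unique (f (x G.⁻¹)) (f x) (begin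
      f (x G.⁻¹) ∙ f x    ≈⟨ f-∙ (x G.⁻¹) x ⟨
      f (x G.⁻¹ G.∙ x)    ≈⟨ f-cong (G.inverseˡ x) ⟩
      f G.ε               ≈⟨ ε-homo ⟩
      ε                   ∎)

module ExteriorAlgebra {c ℓ} (K : Field c ℓ) where
  private module K = Field K
  open RingProperties K.ring using (-0#≈0#)
  open Exterior K

  E-abelianGroup : ℕ → AbelianGroup c ℓ
  E-abelianGroup n = Pointwise.abelianGroup (Subset n) K.+-abelianGroup

  private
    open module EG {n : ℕ} = AbelianGroup (E-abelianGroup n)
      using (refl; sym; trans; ∙-cong; ⁻¹-cong; assoc; identityˡ; identityʳ; inverseʳ)
    open module EGP {n : ℕ} = AbelianGroupProperties (E-abelianGroup n)
      using (⁻¹-involutive; ε⁻¹≈ε; ⁻¹-∙-comm)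
    open module ECS {n : ℕ} = CommutativeSemigroupProperties
      (AbelianGroup.commutativeSemigroup (E-abelianGroup n)) using (interchange)
    open module ≈-Reasoning {n : ℕ} = SetoidReasoning (AbelianGroup.setoid (E-abelianGroup n))
    module Additive {n : ℕ} = AdditiveMap (EG.group {n}) (EG.group {n})

  lo-hi-≈ : ∀ {n} {x y : E (suc n)} → lo x ≈E lo y → hi x ≈E hi y → x ≈E y
  lo-hi-≈ p q (false ∷ S) = p S
  lo-hi-≈ p q (true ∷ S)  = q S

  inv-cong : ∀ {n} {x y : E n} → x ≈E y → inv x ≈E inv y
  inv-cong {zero}  p = p
  inv-cong {suc n} p = lo-hi-≈
    (inv-cong (λ S → p (false ∷ S)))
    (⁻¹-cong (inv-cong (λ S → p (true ∷ S))))

  inv-+ : ∀ {n} (x y : E n) → inv (x +E y) ≈E (inv x +E inv y)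
  inv-+ {zero}  x y = refl
  inv-+ {suc n} x y = lo-hi-≈ (inv-+ (lo x) (lo y))
    (trans (⁻¹-cong (inv-+ (hi x) (hi y))) (sym (⁻¹-∙-comm _ _)))

  inv-0 : ∀ {n} → inv (0E {n}) ≈E 0E
  inv-0 = Additive.ε-homo inv-cong inv-+

  inv-neg : ∀ {n} (x : E n) → inv (-E x) ≈E (-E inv x)
  inv-neg = Additive.⁻¹-homo inv-cong inv-+

  inv-involutive : ∀ {n} (x : E n) → inv (inv x) ≈E x
  inv-involutive {zero}  x = refl
  inv-involutive {suc n} x = lo-hi-≈ (inv-involutive (lo x)) (begin
    -E inv (-E inv (hi x))  ≈⟨ ⁻¹-cong (inv-neg (inv (hi x))) ⟩
    -E (-E inv (inv (hi x))) ≈⟨ ⁻¹-involutive _ ⟩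
    inv (inv (hi x))         ≈⟨ inv-involutive (hi x) ⟩
    hi x                     ∎)

  ∂-cong : ∀ {n} {x y : E n} → x ≈E y → ∂ x ≈E ∂ y
  ∂-cong {zero}  p = refl
  ∂-cong {suc n} p = lo-hi-≈
    (∙-cong (∂-cong (λ S → p (false ∷ S))) (λ S → p (true ∷ S)))
    (⁻¹-cong (∂-cong (λ S → p (true ∷ S))))

  ∂-+ : ∀ {n} (x y : E n) → ∂ (x +E y) ≈E (∂ x +E ∂ y)
  ∂-+ {zero}  x y = sym (identityʳ 0E)
  ∂-+ {suc n} x y = lo-hi-≈
    (trans (∙-cong (∂-+ (lo x) (lo y)) refl) (interchange _ _ _ _))
    (trans (⁻¹-cong (∂-+ (hi x) (hi y))) (sym (⁻¹-∙-comm _ _)))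

  ∂-0 : ∀ {n} → ∂ (0E {n}) ≈E 0E
  ∂-0 = Additive.ε-homo ∂-cong ∂-+

  ∂-neg : ∀ {n} (x : E n) → ∂ (-E x) ≈E (-E ∂ x)
  ∂-neg = Additive.⁻¹-homo ∂-cong ∂-+

  ∂-inv : ∀ {n} (x : E n) → ∂ (inv x) ≈E (-E inv (∂ x))
  ∂-inv {zero}  x = sym ε⁻¹≈ε
  ∂-inv {suc n} x = lo-hi-≈
    (begin
      ∂ (inv (lo x)) +E (-E inv (hi x))      ≈⟨ ∙-cong (∂-inv (lo x)) refl ⟩
      (-E inv (∂ (lo x))) +E (-E inv (hi x)) ≈⟨ ⁻¹-∙-comm _ _ ⟩
      -E (inv (∂ (lo x)) +E inv (hi x))      ≈⟨ ⁻¹-cong (inv-+ _ _) ⟨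
      -E inv (∂ (lo x) +E hi x)              ∎)
    (begin
      -E ∂ (-E inv (hi x))         ≈⟨ ⁻¹-cong (∂-neg _) ⟩
      -E (-E ∂ (inv (hi x)))       ≈⟨ ⁻¹-cong (⁻¹-cong (∂-inv (hi x))) ⟩
      -E (-E (-E inv (∂ (hi x))))  ≈⟨ ⁻¹-cong (⁻¹-cong (inv-neg _)) ⟨
      -E (-E inv (-E ∂ (hi x)))    ∎)

  ∂∂≈0 : ∀ {n} (x : E n) → ∂ (∂ x) ≈E 0E
  ∂∂≈0 {zero}  x = refl
  ∂∂≈0 {suc n} x = lo-hi-≈
    (begin
      ∂ (∂ (lo x) +E hi x) +E (-E ∂ (hi x))      ≈⟨ ∙-cong (∂-+ _ _) refl ⟩
      (∂ (∂ (lo x)) +E ∂ (hi x)) +E (-E ∂ (hi x)) ≈⟨ ∙-cong (∙-cong (∂∂≈0 (lo x)) refl) refl ⟩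
      (0E +E ∂ (hi x)) +E (-E ∂ (hi x))          ≈⟨ ∙-cong (identityˡ _) refl ⟩
      ∂ (hi x) +E (-E ∂ (hi x))                  ≈⟨ inverseʳ _ ⟩
      0E                                         ∎)
    (begin
      -E ∂ (-E ∂ (hi x))  ≈⟨ ⁻¹-cong (∂-neg _) ⟩
      -E (-E ∂ (∂ (hi x))) ≈⟨ ⁻¹-involutive _ ⟩
      ∂ (∂ (hi x))         ≈⟨ ∂∂≈0 (hi x) ⟩
      0E                   ∎)

  ∧-cong : ∀ {n} {x x' y y' : E n} → x ≈E x' → y ≈E y' → (x ∧ y) ≈E (x' ∧ y')
  ∧-cong {zero}  p q [] = K.*-cong (p []) (q [])
  ∧-cong {suc n} p q = lo-hi-≈
    (∧-cong (λ S → p (false ∷ S)) (λ S → q (false ∷ S)))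
    (∙-cong (∧-cong (λ S → p (true ∷ S)) (λ S → q (false ∷ S)))
            (∧-cong (inv-cong (λ S → p (false ∷ S))) (λ S → q (true ∷ S))))

  ∧-distribˡ : ∀ {n} (x y z : E n) → (x ∧ (y +E z)) ≈E ((x ∧ y) +E (x ∧ z))
  ∧-distribˡ {zero}  x y z [] = K.distribˡ (x []) (y []) (z [])
  ∧-distribˡ {suc n} x y z = lo-hi-≈ (∧-distribˡ (lo x) (lo y) (lo z))
    (trans (∙-cong (∧-distribˡ (hi x) (lo y) (lo z)) (∧-distribˡ (inv (lo x)) (hi y) (hi z)))
           (interchange _ _ _ _))

  ∧-distribʳ : ∀ {n} (x y z : E n) → ((x +E y) ∧ z) ≈E ((x ∧ z) +E (y ∧ z))
  ∧-distribʳ {zero}  x y z [] = K.distribʳ (z []) (x []) (y [])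
  ∧-distribʳ {suc n} x y z = lo-hi-≈ (∧-distribʳ (lo x) (lo y) (lo z))
    (trans (∙-cong (∧-distribʳ (hi x) (hi y) (lo z))
                   (trans (∧-cong (inv-+ (lo x) (lo y)) refl) (∧-distribʳ _ _ _)))
           (interchange _ _ _ _))

  ∧-zeroˡ : ∀ {n} (y : E n) → (0E ∧ y) ≈E 0E
  ∧-zeroˡ y = Additive.ε-homo (λ p → ∧-cong p refl) (λ x x' → ∧-distribʳ x x' y)

  ∧-zeroʳ : ∀ {n} (x : E n) → (x ∧ 0E) ≈E 0E
  ∧-zeroʳ x = Additive.ε-homo (∧-cong refl) (∧-distribˡ x)

  ∧-negˡ : ∀ {n} (x y : E n) → ((-E x) ∧ y) ≈E (-E (x ∧ y))
  ∧-negˡ x y = Additive.⁻¹-homo (λ p → ∧-cong p refl) (λ x x' → ∧-distribʳ x x' y) x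

  ∧-negʳ : ∀ {n} (x y : E n) → (x ∧ (-E y)) ≈E (-E (x ∧ y))
  ∧-negʳ x = Additive.⁻¹-homo (∧-cong refl) (∧-distribˡ x)

  inv-∧ : ∀ {n} (x y : E n) → inv (x ∧ y) ≈E (inv x ∧ inv y)
  inv-∧ {zero}  x y = refl
  inv-∧ {suc n} x y = lo-hi-≈ (inv-∧ (lo x) (lo y)) (begin
    -E inv ((hi x ∧ lo y) +E (inv (lo x) ∧ hi y))
      ≈⟨ ⁻¹-cong (trans (inv-+ _ _) (∙-cong (inv-∧ (hi x) (lo y)) (inv-∧ (inv (lo x)) (hi y)))) ⟩
    -E ((inv (hi x) ∧ inv (lo y)) +E (inv (inv (lo x)) ∧ inv (hi y)))
      ≈⟨ ⁻¹-∙-comm _ _ ⟨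
    (-E (inv (hi x) ∧ inv (lo y))) +E (-E (inv (inv (lo x)) ∧ inv (hi y)))
      ≈⟨ ∙-cong (∧-negˡ _ _) (∧-negʳ _ _) ⟨
    ((-E inv (hi x)) ∧ inv (lo y)) +E (inv (inv (lo x)) ∧ (-E inv (hi y)))
      ∎)

  ∧-assoc : ∀ {n} (x y z : E n) → ((x ∧ y) ∧ z) ≈E (x ∧ (y ∧ z))
  ∧-assoc {zero}  x y z [] = K.*-assoc (x []) (y []) (z [])
  ∧-assoc {suc n} x y z = lo-hi-≈ (∧-assoc (lo x) (lo y) (lo z)) (begin
    (((hi x ∧ lo y) +E (inv (lo x) ∧ hi y)) ∧ lo z) +E (inv (lo x ∧ lo y) ∧ hi z)
      ≈⟨ ∙-cong (∧-distribʳ _ _ _) (∧-cong (inv-∧ (lo x) (lo y)) refl) ⟩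
    (((hi x ∧ lo y) ∧ lo z) +E ((inv (lo x) ∧ hi y) ∧ lo z)) +E ((inv (lo x) ∧ inv (lo y)) ∧ hi z)
      ≈⟨ ∙-cong (∙-cong (∧-assoc _ _ _) (∧-assoc _ _ _)) (∧-assoc _ _ _) ⟩
    ((hi x ∧ (lo y ∧ lo z)) +E (inv (lo x) ∧ (hi y ∧ lo z))) +E (inv (lo x) ∧ (inv (lo y) ∧ hi z))
      ≈⟨ assoc _ _ _ ⟩
    (hi x ∧ (lo y ∧ lo z)) +E ((inv (lo x) ∧ (hi y ∧ lo z)) +E (inv (lo x) ∧ (inv (lo y) ∧ hi z)))
      ≈⟨ ∙-cong refl (∧-distribˡ _ _ _) ⟨
    (hi x ∧ (lo y ∧ lo z)) +E (inv (lo x) ∧ ((hi y ∧ lo z) +E (inv (lo y) ∧ hi z)))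
      ∎)

  -- The hi part of the Leibniz rule; the two occurrences of F on the right cancel.
  ∂-leibniz-regroup : ∀ {n} (A B C D F : E n) →
    (-E ((A +E B) +E ((-E C) +E D))) ≈E (((-E A) +E (C +E F)) +E ((-E (B +E F)) +E (-E D)))
  ∂-leibniz-regroup {n} A B C D F = begin
    -E ((A +E B) +E ((-E C) +E D))
      ≈⟨ ⁻¹-∙-comm _ _ ⟨
    (-E (A +E B)) +E (-E ((-E C) +E D))
      ≈⟨ ∙-cong (⁻¹-∙-comm A B) (trans (∙-cong (sym (⁻¹-involutive C)) refl) (⁻¹-∙-comm _ _)) ⟨
    ((-E A) +E (-E B)) +E (C +E (-E D))
      ≈⟨ identityʳ _ ⟨
    (((-E A) +E (-E B)) +E (C +E (-E D))) +E 0E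
      ≈⟨ ∙-cong refl (inverseʳ F) ⟨
    (((-E A) +E (-E B)) +E (C +E (-E D))) +E (F +E (-E F))
      ≈⟨ solve 6 (λ a b c d f g → (((a ⊕ b) ⊕ (c ⊕ d)) ⊕ (f ⊕ g)) ⊜ ((a ⊕ (c ⊕ f)) ⊕ ((b ⊕ g) ⊕ d)))
               refl (-E A) (-E B) C (-E D) F (-E F) ⟩
    ((-E A) +E (C +E F)) +E (((-E B) +E (-E F)) +E (-E D))
      ≈⟨ ∙-cong refl (∙-cong (⁻¹-∙-comm B F) refl) ⟩
    ((-E A) +E (C +E F)) +E ((-E (B +E F)) +E (-E D))
      ∎
    where
    open CommutativeMonoidSolver (AbelianGroup.commutativeMonoid (E-abelianGroup n))
      using (solve; _⊜_; _⊕_)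

  ∂-leibniz : ∀ {n} (x y : E n) → ∂ (x ∧ y) ≈E ((∂ x ∧ y) +E (inv x ∧ ∂ y))
  ∂-leibniz {zero}  x y = sym (trans (∙-cong (∧-zeroˡ y) (∧-zeroʳ x)) (identityʳ 0E))
  ∂-leibniz {suc n} x y = lo-hi-≈
    (begin
      ∂ (x₀ ∧ y₀) +E ((x₁ ∧ y₀) +E (inv x₀ ∧ y₁))
        ≈⟨ ∙-cong (∂-leibniz x₀ y₀) refl ⟩
      ((∂ x₀ ∧ y₀) +E (inv x₀ ∧ ∂ y₀)) +E ((x₁ ∧ y₀) +E (inv x₀ ∧ y₁))
        ≈⟨ interchange _ _ _ _ ⟩
      ((∂ x₀ ∧ y₀) +E (x₁ ∧ y₀)) +E ((inv x₀ ∧ ∂ y₀) +E (inv x₀ ∧ y₁))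
        ≈⟨ ∙-cong (∧-distribʳ _ _ _) (∧-distribˡ _ _ _) ⟨
      ((∂ x₀ +E x₁) ∧ y₀) +E (inv x₀ ∧ (∂ y₀ +E y₁))
        ∎)
    (begin
      -E ∂ ((x₁ ∧ y₀) +E (inv x₀ ∧ y₁))
        ≈⟨ ⁻¹-cong (trans (∂-+ _ _) (∙-cong (∂-leibniz x₁ y₀) (∂-leibniz (inv x₀) y₁))) ⟩
      -E (((∂ x₁ ∧ y₀) +E (inv x₁ ∧ ∂ y₀)) +E ((∂ (inv x₀) ∧ y₁) +E (inv (inv x₀) ∧ ∂ y₁)))
        ≈⟨ ⁻¹-cong (∙-cong refl (∙-cong (trans (∧-cong (∂-inv x₀) refl) (∧-negˡ _ _))
                                       (∧-cong (inv-involutive x₀) refl))) ⟩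
      -E ((A +E B) +E ((-E C) +E D))
        ≈⟨ ∂-leibniz-regroup A B C D F ⟩
      ((-E A) +E (C +E F)) +E ((-E (B +E F)) +E (-E D))
        ≈⟨ ∙-cong (∙-cong (∧-negˡ _ _) (∧-distribʳ _ _ _))
                  (∙-cong (trans (∧-negˡ _ _) (⁻¹-cong (∧-distribˡ _ _ _)))
                          (trans (∧-negʳ _ _) (⁻¹-cong (∧-cong (inv-involutive x₀) refl)))) ⟨
      (((-E ∂ x₁) ∧ y₀) +E ((inv (∂ x₀) +E inv x₁) ∧ y₁))
        +E (((-E inv x₁) ∧ (∂ y₀ +E y₁)) +E (inv (inv x₀) ∧ (-E ∂ y₁)))
        ≈⟨ ∙-cong (∙-cong refl (∧-cong (inv-+ _ _) refl)) refl ⟨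
      (((-E ∂ x₁) ∧ y₀) +E (inv (∂ x₀ +E x₁) ∧ y₁))
        +E (((-E inv x₁) ∧ (∂ y₀ +E y₁)) +E (inv (inv x₀) ∧ (-E ∂ y₁)))
        ∎)
    where
    x₀ x₁ y₀ y₁ A B C D F : E n
    x₀ = lo x
    x₁ = hi x
    y₀ = lo y
    y₁ = hi y
    A = ∂ x₁ ∧ y₀
    B = inv x₁ ∧ ∂ y₀
    C = inv (∂ x₀) ∧ y₁
    D = x₀ ∧ ∂ y₁
    F = inv x₁ ∧ y₁

  inv-basis : ∀ {n} (S : Subset n) → (inv (basis S) ≈E basis S) ⊎ (inv (basis S) ≈E (-E basis S))
  inv-basis {zero}  []          = inj₁ refl
  inv-basis {suc n} (false ∷ S) with inv-basis S
  ... | inj₁ p = inj₁ (lo-hi-≈ p (trans (⁻¹-cong inv-0) ε⁻¹≈ε))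
  ... | inj₂ p = inj₂ (lo-hi-≈ p (⁻¹-cong inv-0))
  inv-basis {suc n} (true ∷ S) with inv-basis S
  ... | inj₁ p = inj₂ (lo-hi-≈ (trans inv-0 (sym ε⁻¹≈ε)) (⁻¹-cong p))
  ... | inj₂ p = inj₁ (lo-hi-≈ inv-0 (trans (⁻¹-cong p) (⁻¹-involutive _)))

  inv-∂basis : ∀ {n} (S : Subset n) →
    (inv (∂ (basis S)) ≈E ∂ (basis S)) ⊎ (inv (∂ (basis S)) ≈E (-E ∂ (basis S)))
  inv-∂basis S with inv-basis S
  ... | inj₁ p = inj₂ (begin
    inv (∂ (basis S))       ≈⟨ ⁻¹-involutive _ ⟨
    -E (-E inv (∂ (basis S))) ≈⟨ ⁻¹-cong (∂-inv (basis S)) ⟨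
    -E ∂ (inv (basis S))      ≈⟨ ⁻¹-cong (∂-cong p) ⟩
    -E ∂ (basis S)            ∎)
  ... | inj₂ p = inj₁ (begin
    inv (∂ (basis S))       ≈⟨ ⁻¹-involutive _ ⟨
    -E (-E inv (∂ (basis S))) ≈⟨ ⁻¹-cong (∂-inv (basis S)) ⟨
    -E ∂ (inv (basis S))      ≈⟨ ⁻¹-cong (trans (∂-cong p) (∂-neg _)) ⟩
    -E (-E ∂ (basis S))       ≈⟨ ⁻¹-involutive _ ⟩
    ∂ (basis S)               ∎)

  inv-1 : ∀ {n} → inv (1E {n}) ≈E 1E
  inv-1 {zero}  = refl
  inv-1 {suc n} = lo-hi-≈ inv-1 (trans (⁻¹-cong inv-0) ε⁻¹≈ε)

  ∂-1 : ∀ {n} → ∂ (1E {n}) ≈E 0E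
  ∂-1 {zero}  = refl
  ∂-1 {suc n} = lo-hi-≈ (trans (identityʳ _) ∂-1) (trans (⁻¹-cong ∂-0) ε⁻¹≈ε)

  ∧-identityˡ : ∀ {n} (x : E n) → (1E ∧ x) ≈E x
  ∧-identityˡ {zero}  x [] = K.*-identityˡ (x [])
  ∧-identityˡ {suc n} x = lo-hi-≈ (∧-identityˡ (lo x))
    (trans (∙-cong (∧-zeroˡ _) (trans (∧-cong inv-1 refl) (∧-identityˡ (hi x)))) (identityˡ _))

  inv-var : ∀ {n} (i : Fin n) → inv (var i) ≈E (-E var i)
  inv-var zero    = lo-hi-≈ (trans inv-0 (sym ε⁻¹≈ε)) (⁻¹-cong inv-1)
  inv-var (suc i) = lo-hi-≈ (inv-var i) (⁻¹-cong inv-0)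

  ∂-var : ∀ {n} (i : Fin n) → ∂ (var i) ≈E 1E
  ∂-var zero    = lo-hi-≈ (trans (∙-cong ∂-0 refl) (identityˡ _)) (trans (⁻¹-cong ∂-1) ε⁻¹≈ε)
  ∂-var (suc i) = lo-hi-≈ (trans (identityʳ _) (∂-var i)) (trans (⁻¹-cong ∂-0) ε⁻¹≈ε)

  var-∧-var : ∀ {n} (i : Fin n) → (var i ∧ var i) ≈E 0E
  var-∧-var zero    = lo-hi-≈ (∧-zeroˡ _)
    (trans (∙-cong (∧-zeroʳ _) (trans (∧-cong inv-0 refl) (∧-zeroˡ _))) (identityʳ 0E))
  var-∧-var (suc i) = lo-hi-≈ (var-∧-var i) (trans (∙-cong (∧-zeroˡ _) (∧-zeroʳ _)) (identityʳ 0E))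

  ∂-var-∧ : ∀ {n} (i : Fin n) (x : E n) → ∂ (var i ∧ x) ≈E (x -E (var i ∧ ∂ x))
  ∂-var-∧ i x = begin
    ∂ (var i ∧ x)
      ≈⟨ ∂-leibniz (var i) x ⟩
    (∂ (var i) ∧ x) +E (inv (var i) ∧ ∂ x)
      ≈⟨ ∙-cong (∧-cong (∂-var i) refl) (∧-cong (inv-var i) refl) ⟩
    (1E ∧ x) +E ((-E var i) ∧ ∂ x)
      ≈⟨ ∙-cong (∧-identityˡ x) (∧-negˡ _ _) ⟩
    x +E (-E (var i ∧ ∂ x))
      ∎

  var-∧-cancel : ∀ {n} (i : Fin n) (x y : E n) → (var i ∧ (x -E (var i ∧ y))) ≈E (var i ∧ x)
  var-∧-cancel i x y = begin
    var i ∧ (x +E (-E (var i ∧ y)))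
      ≈⟨ ∧-distribˡ _ _ _ ⟩
    (var i ∧ x) +E (var i ∧ (-E (var i ∧ y)))
      ≈⟨ ∙-cong refl (trans (∧-negʳ _ _) (⁻¹-cong (sym (∧-assoc _ _ _)))) ⟩
    (var i ∧ x) +E (-E ((var i ∧ var i) ∧ y))
      ≈⟨ ∙-cong refl (⁻¹-cong (trans (∧-cong (var-∧-var i) refl) (∧-zeroˡ y))) ⟩
    (var i ∧ x) +E (-E 0E)
      ≈⟨ ∙-cong refl ε⁻¹≈ε ⟩
    (var i ∧ x) +E 0E
      ≈⟨ identityʳ _ ⟩
    var i ∧ x
      ∎

  module _ {n} {I : Pred n}
           (I-resp : ∀ {x y} → x ≈E y → I y → I x)
           (I-∧ˡ : ∀ w {x} → I x → I (w ∧ x))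
           (I-∂ : ∀ {x} → I x → I (∂ x)) where

    var-isRegular : (i : Fin n) → IsRegular I (var i)
    var-isRegular i x = annihilated⇒multiple , multiple⇒annihilated
      where
      annihilated⇒multiple : I (var i ∧ x) → (I +⟨ var i ⟩) x
      annihilated⇒multiple h = ∂ x , I-resp (sym (∂-var-∧ i x)) (I-∂ h)

      multiple⇒annihilated : (I +⟨ var i ⟩) x → I (var i ∧ x)
      multiple⇒annihilated (y , h) = I-resp (sym (var-∧-cancel i x y)) (I-∧ˡ (var i) h)

  -- x ∅ is the coefficient of e_∅ = 1, i.e. the constant term.
  Augmented : ∀ {n} → E n → Set ℓ
  Augmented x = x ∅ K.≈ K.0#

  constantTerm-∧ : ∀ {n} (x y : E n) → (x ∧ y) ∅ K.≈ (x ∅ K.* y ∅)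
  constantTerm-∧ {zero}  x y = K.refl
  constantTerm-∧ {suc n} x y = constantTerm-∧ (lo x) (lo y)

  constantTerm-1 : ∀ {n} → 1E {n} ∅ K.≈ K.1#
  constantTerm-1 {zero}  = K.refl
  constantTerm-1 {suc n} = constantTerm-1 {n}

  ∧-augmentedˡ : ∀ {n} (x y : E n) → Augmented x → Augmented (x ∧ y)
  ∧-augmentedˡ x y x₊ = K.trans (constantTerm-∧ x y) (K.trans (K.*-cong x₊ K.refl) (K.zeroˡ _))

  ∧-augmentedʳ : ∀ {n} (x y : E n) → Augmented y → Augmented (x ∧ y)
  ∧-augmentedʳ x y y₊ = K.trans (constantTerm-∧ x y) (K.trans (K.*-cong K.refl y₊) (K.zeroʳ _))

  var-augmented : ∀ {n} (i : Fin n) → Augmented (var i)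
  var-augmented zero    = K.refl
  var-augmented (suc i) = var-augmented i

  basis-augmented : ∀ {n} (S : Subset n) → (S ≡ ∅) ⊎ Augmented (basis S)
  basis-augmented {zero}  []          = inj₁ P.refl
  basis-augmented {suc n} (false ∷ S) with basis-augmented S
  ... | inj₁ S≡∅ = inj₁ (cong (false ∷_) S≡∅)
  ... | inj₂ e₊  = inj₂ e₊
  basis-augmented {suc n} (true ∷ S) = inj₂ K.refl

  ∂basis-augmented : ∀ {n} (S : Subset n) →
    (S ≡ ∅) ⊎ (∃ λ i → S ≡ ⁅ i ⁆) ⊎ Augmented (∂ (basis S))
  ∂basis-augmented {zero}  []          = inj₁ P.refl
  ∂basis-augmented {suc n} (false ∷ S) with ∂basis-augmented S
  ... | inj₁ S≡∅              = inj₁ (cong (false ∷_) S≡∅)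
  ... | inj₂ (inj₁ (i , S≡i)) = inj₂ (inj₁ (suc i , cong (false ∷_) S≡i))
  ... | inj₂ (inj₂ ∂e₊)       = inj₂ (inj₂ (K.trans (K.+-identityʳ _) ∂e₊))
  ∂basis-augmented {suc n} (true ∷ S) with basis-augmented S
  ... | inj₁ S≡∅ = inj₂ (inj₁ (zero , cong (true ∷_) S≡∅))
  ... | inj₂ e₊  = inj₂ (inj₂ (K.trans (K.+-cong (∂-0 {n} ∅) e₊) (K.+-identityʳ K.0#)))

  +⟨⟩-nonZero : ∀ {n} (I : Pred n) (v : E n) →
    (∀ {x} → I x → Augmented x) → Augmented v → NonZeroQuot (I +⟨ v ⟩)
  +⟨⟩-nonZero {n} I v I₊ v₊ everything with everything 1E
  ... | y , h = K.1≉0 (K.trans (K.sym 1-vy≈1) (I₊ h))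
    where
    1-vy≈1 : (1E -E (v ∧ y)) ∅ K.≈ K.1#
    1-vy≈1 = K.trans (K.+-cong (constantTerm-1 {n}) (K.trans (K.-‿cong (∧-augmentedˡ v y v₊)) -0#≈0#))
                     (K.+-identityʳ K.1#)

  module _ {n} (M : Matroid n) where
    open Matroid M using (Indep; indep-∅; Dependent; Loopless)

    OS-resp : ∀ {x y} → x ≈E y → OS M y → OS M x
    OS-resp {y = y} x≈y y∈OS = os-add y 0E y∈OS (os-zero refl) (trans x≈y (sym (identityʳ y)))

    OS-∧ˡ : ∀ w {x} → OS M x → OS M (w ∧ x)
    OS-∧ˡ w (os-zero x≈0) = os-zero (trans (∧-cong refl x≈0) (∧-zeroʳ w))
    OS-∧ˡ w (os-add y z y∈OS z∈OS x≈y+z) =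
      os-add (w ∧ y) (w ∧ z) (OS-∧ˡ w y∈OS) (OS-∧ˡ w z∈OS)
        (trans (∧-cong refl x≈y+z) (∧-distribˡ w y z))
    OS-∧ˡ w (os-gen a b S dep x≈agb) = os-gen (w ∧ a) b S dep (begin
      w ∧ _                          ≈⟨ ∧-cong refl x≈agb ⟩
      w ∧ ((a ∧ ∂ (basis S)) ∧ b)    ≈⟨ ∧-assoc _ _ _ ⟨
      (w ∧ (a ∧ ∂ (basis S))) ∧ b    ≈⟨ ∧-cong (∧-assoc _ _ _) refl ⟨
      ((w ∧ a) ∧ ∂ (basis S)) ∧ b    ∎)

    OS-∂ : ∀ {x} → OS M x → OS M (∂ x)
    OS-∂ (os-zero x≈0) = os-zero (trans (∂-cong x≈0) ∂-0)
    OS-∂ (os-add y z y∈OS z∈OS x≈y+z) =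
      os-add (∂ y) (∂ z) (OS-∂ y∈OS) (OS-∂ z∈OS) (trans (∂-cong x≈y+z) (∂-+ y z))
    OS-∂ (os-gen a b S dep x≈agb) = OS-resp (trans (∂-cong x≈agb) expand)
      (os-add _ _ (os-add _ _ (os-gen (∂ a) b S dep refl) (os-zero middle≈0) refl) last∈OS refl)
      where
      g : E n
      g = ∂ (basis S)

      expand : ∂ ((a ∧ g) ∧ b)
               ≈E ((((∂ a ∧ g) ∧ b) +E ((inv a ∧ ∂ g) ∧ b)) +E ((inv a ∧ inv g) ∧ ∂ b))
      expand = begin
        ∂ ((a ∧ g) ∧ b)
          ≈⟨ ∂-leibniz (a ∧ g) b ⟩
        (∂ (a ∧ g) ∧ b) +E (inv (a ∧ g) ∧ ∂ b)
          ≈⟨ ∙-cong (∧-cong (∂-leibniz a g) refl) (∧-cong (inv-∧ a g) refl) ⟩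
        (((∂ a ∧ g) +E (inv a ∧ ∂ g)) ∧ b) +E ((inv a ∧ inv g) ∧ ∂ b)
          ≈⟨ ∙-cong (∧-distribʳ _ _ _) refl ⟩
        (((∂ a ∧ g) ∧ b) +E ((inv a ∧ ∂ g) ∧ b)) +E ((inv a ∧ inv g) ∧ ∂ b)
          ∎

      middle≈0 : ((inv a ∧ ∂ g) ∧ b) ≈E 0E
      middle≈0 = trans (∧-cong (trans (∧-cong refl (∂∂≈0 (basis S))) (∧-zeroʳ _)) refl) (∧-zeroˡ b)

      last∈OS : OS M ((inv a ∧ inv g) ∧ ∂ b)
      last∈OS with inv-∂basis S
      ... | inj₁ ig≈g  = os-gen (inv a) (∂ b) S dep (∧-cong (∧-cong refl ig≈g) refl)
      ... | inj₂ ig≈-g = os-gen (-E inv a) (∂ b) S dep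
                           (∧-cong (trans (∧-cong refl ig≈-g) (trans (∧-negʳ _ _) (sym (∧-negˡ _ _)))) refl)

    OS-augmented : Loopless → ∀ {x} → OS M x → Augmented x
    OS-augmented loopless (os-zero x≈0) = x≈0 ∅
    OS-augmented loopless (os-add y z y∈OS z∈OS x≈y+z) =
      K.trans (x≈y+z ∅) (K.trans (K.+-cong (OS-augmented loopless y∈OS) (OS-augmented loopless z∈OS))
                                (K.+-identityʳ K.0#))
    OS-augmented loopless (os-gen a b S dep x≈agb) =
      K.trans (x≈agb ∅) (∧-augmentedˡ _ b (∧-augmentedʳ a _ ∂e₊))
      where
      ∂e₊ : Augmented (∂ (basis S))
      ∂e₊ with ∂basis-augmented S
      ... | inj₁ S≡∅              = ⊥-elim (dep (subst Indep (P.sym S≡∅) indep-∅))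
      ... | inj₂ (inj₁ (i , S≡i)) = ⊥-elim (loopless i (subst Dependent S≡i dep))
      ... | inj₂ (inj₂ ∂e₊)       = ∂e₊

proposition6p3 : ∀ {c ℓ : Level} (K : Field c ℓ) (n : ℕ) (M : Matroid n) →
    Matroid.Loopless M →
    ∀ (i : Fin n) →
    Exterior.IsRegular K (Exterior.OS K M) (Exterior.var K i)
    × Exterior.IsRegularSeq K (Exterior.OS K M) (Exterior.var K i ∷ [])
proposition6p3 K n M loopless i =
  e_i-regular , e_i-regular , +⟨⟩-nonZero (OS M) (var i) (OS-augmented M loopless) (var-augmented i)
  where
  open Exterior K
  open ExteriorAlgebra K

  e_i-regular : IsRegular (OS M) (var i)
  e_i-regular = var-isRegular (OS-resp M) (OS-∧ˡ M) (OS-∂ M) i
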